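{- Let $k<n$ be positive integers. Let $\mathcal{A}$ be a set of monotone drawing sequences of length $n$, each pair of which cross at most $k$ times. Then $|\mathcal{A}| \leq 2\binom{2n}{k+1}$.
   Context: A monotone drawing sequence is a finite sequence with entries in $\{+,0,-,\ast\}$ of one of the forms: (i) some number ($\geq 0$) of $\ast$'s, then $0$, then some number ($\geq0$) of entries each $+$ or $-$, then $0$, then some number ($\geq 0$) of $\ast$'s; or (ii) some number ($\geq0$) of entries each $+$ or $-$, then $0$, then some number ($\geq0$) of $\ast$'s. Partially order the symbols by $-<0<+$, with $\ast$ incomparable to the others. For sequences $(a_i),(b_i)$, $(a_i)$ is below $(b_i)$ at $j$ if $a_j<b_j$ and above at $j$ if $a_j>b_j$. Two sequences cross $k$ times if there are indices $i_0<i_1<\dots<i_k$ such that $(a_i)$ is below $(b_i)$ at $i_0,i_2,i_4,\dots$ and above at $i_1,i_3,\dots$, or vice versa; they cross at most $k$ times if they do not cross $k+1$ times. -}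

module Defs where

open import Data.Nat using (ℕ; zero; suc; _+_; _<_)
open import Data.Empty using (⊥)
open import Data.Bool using (Bool; true; false; if_then_else_)
open import Data.Fin using (Fin; toℕ)
open import Data.Fin.Base using () renaming (_<_ to _<ᶠ_)
open import Data.List using (List; []; _∷_; _++_; replicate; length)
open import Data.List.Relation.Unary.All using (All)
open import Data.Vec using (Vec; lookup; toList)
open import Data.Product using (Σ; ∃; ∃-syntax; _×_; _,_)
open import Data.Sum using (_⊎_)
open import Relation.Binary.PropositionalEquality using (_≡_)

even : ℕ → Bool
even zero = true
even (suc zero) = false
even (suc (suc n)) = even n

data Sym : Set where
  plus zer minus star : Sym

data _≺_ : Sym → Sym → Set where
  m≺z : minus ≺ zer
  z≺p : zer ≺ plus
  m≺p : minus ≺ plus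

data IsSign : Sym → Set where
  sign+ : IsSign plus
  sign- : IsSign minus

data MonotoneDrawingList : List Sym → Set where
  form-i  : (a b : ℕ) (w : List Sym) → All IsSign w →
            MonotoneDrawingList (replicate a star ++ (zer ∷ w) ++ (zer ∷ replicate b star))
  form-ii : (b : ℕ) (w : List Sym) → All IsSign w →
            MonotoneDrawingList (w ++ (zer ∷ replicate b star))

Seq : ℕ → Set
Seq n = Vec Sym n

MonotoneDrawingSeq : {n : ℕ} → Seq n → Set
MonotoneDrawingSeq s = MonotoneDrawingList (toList s)

Below : {n : ℕ} → Seq n → Seq n → Fin n → Set
Below a b j = lookup a j ≺ lookup b j

Above : {n : ℕ} → Seq n → Seq n → Fin n → Set
Above a b j = lookup b j ≺ lookup a j

StrictlyIncreasing : {m n : ℕ} → (Fin m → Fin n) → Set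
StrictlyIncreasing {m} f = (s t : Fin m) → s <ᶠ t → f s <ᶠ f t

AlternatesFromBelow : {n m : ℕ} → Seq n → Seq n → (Fin m → Fin n) → Set
AlternatesFromBelow a b f =
  ∀ t → (if even (toℕ t) then Below a b (f t) else Above a b (f t))

Cross : {n : ℕ} → ℕ → Seq n → Seq n → Set
Cross {n} k a b =
  Σ (Fin (suc k) → Fin n) λ i → StrictlyIncreasing i ×
    (AlternatesFromBelow a b i ⊎ AlternatesFromBelow b a i)

CrossAtMost : {n : ℕ} → ℕ → Seq n → Seq n → Set
CrossAtMost k a b = Cross (suc k) a b → ⊥

{-# OPTIONS --safe #-}
-- The suffixes of monotone drawing sequences are ∗…∗, w 0 ∗…∗ and
-- ∗…∗ 0 w 0 ∗…∗ with w ∈ {+,−}*, so removing the first symbol turns a family F of suffixes of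
-- length m + 1 into the family of their tails. A tail z is counted in F once for every first
-- symbol x with x z ∈ F. If ∗ and another symbol both occur, z is ∗…∗, so this happens for at
-- most one z. Otherwise z has two first symbols a < c and is of the form w 0 ∗…∗; if two such
-- forks z₁, z₂ with the same c cross j times, then c z₁, a₂ z₂ or a₁ z₁, c z₂ cross j + 1 times.
-- Counting the forks with c = 0 and with c = + separately, if no two members of F cross j times,
--   |F| ≤ b(m, j) + 1 + 2 b(m, j − 1),
-- where b(m, j) bounds such families of length m; for j = 1 there is at most one fork of each
-- kind, as distinct sequences w 0 ∗…∗ always cross. By Pascal's rule b(m, j) = 2 C(2m, j)
-- satisfies this recurrence.

module Submission where

open import Defs
open import Data.Nat using (ℕ; zero; suc; _+_; _*_; _≤_; _<_; z≤n; s≤s)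
open import Data.Nat.Properties
  using (≤-trans; <⇒≤; n≤1+n; n<1+n; m≤m+n; m≤n+m; m≤n*m; +-comm; +-assoc; +-suc; *-suc;
         +-mono-≤; +-monoˡ-<; +-commutativeSemigroup; *-monoʳ-≤; m≤n⇒m<n∨m≡n; <-irrefl; module ≤-Reasoning)
open import Algebra.Properties.CommutativeSemigroup +-commutativeSemigroup using (xy∙z≈xz∙y)
open import Data.Nat.Combinatorics using (_C_; nCk+nC[k+1]≡[n+1]C[k+1]; nC1≡n)
open import Data.Nat.Tactic.RingSolver using (solve-∀)
open import Data.Bool using (if_then_else_)
open import Data.Fin using (Fin; zero; suc; toℕ)
open import Data.Fin.Properties using (pigeonhole)
open import Data.Vec using ([]; _∷_; toList)
open import Data.Vec.Properties using (≡-dec)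
open import Data.List using (List; []; _∷_; _++_; replicate; length; filter)
open import Data.List.Properties using (length-++)
open import Data.List.Membership.Propositional using (_∈_)
open import Data.List.Membership.Propositional.Properties using (∈-++⁻; ∈-filter⁻)
open import Data.List.Relation.Unary.Any using (here; there)
open import Data.List.Relation.Unary.All as All using (All; []; _∷_)
open import Data.List.Relation.Unary.AllPairs using (AllPairs; []; _∷_)
open import Data.List.Relation.Unary.Unique.Propositional using (Unique)
import Data.List.Relation.Unary.Unique.Propositional.Properties as Unique
open import Data.Product using (∃-syntax; _×_; _,_; proj₁; proj₂)
import Data.Product as Product
open import Data.Sum using (_⊎_; inj₁; inj₂; [_,_]′)
import Data.Sum as Sum
open import Data.Empty using (⊥-elim)
open import Function using (_∘_)
open import Relation.Nullary using (¬_; yes; no)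
open import Relation.Unary using (Decidable)
open import Relation.Unary.Properties using (∁?)
open import Relation.Binary.Definitions using (DecidableEquality)
open import Relation.Binary.PropositionalEquality
  using (_≡_; _≢_; refl; sym; trans; cong; cong₂; subst; subst₂; module ≡-Reasoning)

-- Lists as finite sets

length-filter-∁ : ∀ {A : Set} {P : A → Set} (P? : Decidable P) xs →
                  length (filter (∁? P?) xs) + length (filter P? xs) ≡ length xs
length-filter-∁ P? [] = refl
length-filter-∁ P? (x ∷ xs) with P? x
... | yes _ = trans (+-suc _ _) (cong suc (length-filter-∁ P? xs))
... | no  _ = cong suc (length-filter-∁ P? xs)

length≤1 : ∀ {A : Set} {xs : List A} → Unique xs → (∀ {x y} → x ∈ xs → y ∈ xs → x ≡ y) → length xs ≤ 1
length≤1 []             _         = z≤n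
length≤1 (_ ∷ [])       _         = s≤s z≤n
length≤1 ((x≢y ∷ _) ∷ _) all-equal = ⊥-elim (x≢y (all-equal (here refl) (there (here refl))))

module ListSet {A : Set} (_≟_ : DecidableEquality A) where
  open import Data.List.Membership.DecPropositional _≟_ using (_∈?_)

  _∪_ _∩_ : List A → List A → List A
  xs ∪ ys = xs ++ filter (∁? (_∈? xs)) ys
  xs ∩ ys = filter (_∈? xs) ys

  length-∪-∩ : ∀ xs ys → length (xs ∪ ys) + length (xs ∩ ys) ≡ length xs + length ys
  length-∪-∩ xs ys = begin
    length (xs ++ ys∖xs) + length (xs ∩ ys)       ≡⟨ cong (_+ length (xs ∩ ys)) (length-++ xs) ⟩
    length xs + length ys∖xs + length (xs ∩ ys)   ≡⟨ +-assoc (length xs) (length ys∖xs) (length (xs ∩ ys)) ⟩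
    length xs + (length ys∖xs + length (xs ∩ ys)) ≡⟨ cong (length xs +_) (length-filter-∁ (_∈? xs) ys) ⟩
    length xs + length ys                         ∎
    where
    open ≡-Reasoning
    ys∖xs : List A
    ys∖xs = filter (∁? (_∈? xs)) ys

  length-∪-∩⁴ : ∀ a b c d →
    length (((a ∪ b) ∪ c) ∪ d) + length (((a ∪ b) ∪ c) ∩ d) + length ((a ∪ b) ∩ c) + length (a ∩ b)
      ≡ length a + length b + length c + length d
  length-∪-∩⁴ a b c d = begin
    # (abc ∪ d) + # (abc ∩ d) + # (ab ∩ c) + # (a ∩ b)
      ≡⟨ cong (λ s → s + # (ab ∩ c) + # (a ∩ b)) (length-∪-∩ abc d) ⟩
    # abc + # d + # (ab ∩ c) + # (a ∩ b)
      ≡⟨ cong (_+ # (a ∩ b)) (xy∙z≈xz∙y (# abc) (# d) (# (ab ∩ c))) ⟩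
    # abc + # (ab ∩ c) + # d + # (a ∩ b)
      ≡⟨ cong (λ s → s + # d + # (a ∩ b)) (length-∪-∩ ab c) ⟩
    # ab + # c + # d + # (a ∩ b)
      ≡⟨ xy∙z≈xz∙y (# ab + # c) (# d) (# (a ∩ b)) ⟩
    # ab + # c + # (a ∩ b) + # d
      ≡⟨ cong (_+ # d) (xy∙z≈xz∙y (# ab) (# c) (# (a ∩ b))) ⟩
    # ab + # (a ∩ b) + # c + # d
      ≡⟨ cong (λ s → s + # c + # d) (length-∪-∩ a b) ⟩
    # a + # b + # c + # d
      ∎
    where
    open ≡-Reasoning
    # : List A → ℕ
    # = length
    ab abc : List A
    ab = a ∪ b
    abc = ab ∪ c

  ∈-∪⁻ : ∀ {z} xs {ys} → z ∈ xs ∪ ys → z ∈ xs ⊎ z ∈ ys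
  ∈-∪⁻ xs z∈ = Sum.map₂ (proj₁ ∘ ∈-filter⁻ (∁? (_∈? xs))) (∈-++⁻ xs z∈)

  ∈-∩⁻ : ∀ {z} xs {ys} → z ∈ xs ∩ ys → z ∈ xs × z ∈ ys
  ∈-∩⁻ xs z∈ = Product.swap (∈-filter⁻ (_∈? xs) z∈)

  ∪-unique : ∀ {xs ys} → Unique xs → Unique ys → Unique (xs ∪ ys)
  ∪-unique {xs} {ys} xs! ys! =
    Unique.++⁺ xs! (Unique.filter⁺ (∁? (_∈? xs)) ys!)
               λ (z∈xs , z∈) → proj₂ (∈-filter⁻ (∁? (_∈? xs)) {xs = ys} z∈) z∈xs

  ∩-unique : ∀ {xs ys} → Unique ys → Unique (xs ∩ ys)
  ∩-unique {xs} = Unique.filter⁺ (_∈? xs)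

-- Binomial coefficients

pascal : ∀ n k → suc n C suc k ≡ n C k + n C suc k
pascal n k = sym (nCk+nC[k+1]≡[n+1]C[k+1] n k)

pascal² : ∀ n k → (2 + n) C (2 + k) ≡ (n C k + n C (1 + k)) + (n C (1 + k) + n C (2 + k))
pascal² n k = trans (pascal (suc n) (suc k)) (cong₂ _+_ (pascal n k) (pascal n (suc k)))

C-pos : ∀ {n k} → k ≤ n → 0 < n C k
C-pos {k = zero}        _         = s≤s z≤n
C-pos {suc n} {suc k} (s≤s k≤n) = subst (0 <_) (sym (pascal n k)) (≤-trans (C-pos k≤n) (m≤m+n _ _))

C-growth : ∀ {n k} → k ≤ n → n C (2 + k) + 2 * (n C (1 + k)) < (2 + n) C (2 + k)
C-growth {n} {k} k≤n = begin-strict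
  W′ + 2 * W          <⟨ +-monoˡ-< (W′ + 2 * W) (C-pos k≤n) ⟩
  V + (W′ + 2 * W)    ≡⟨ rearrange V W W′ ⟩
  (V + W) + (W + W′)  ≡⟨ sym (pascal² n k) ⟩
  (2 + n) C (2 + k)   ∎
  where
  open ≤-Reasoning
  V W W′ : ℕ
  V = n C k
  W = n C (1 + k)
  W′ = n C (2 + k)
  rearrange : ∀ V W W′ → V + (W′ + 2 * W) ≡ (V + W) + (W + W′)
  rearrange = solve-∀

C-middle<neighbours : ∀ {n k} → k ≤ n → (1 + n) C (2 + k) < (1 + n) C (1 + k) + (1 + n) C (3 + k)
C-middle<neighbours {n} {k} k≤n = begin-strict
  (1 + n) C (2 + k)                      ≡⟨ pascal n (1 + k) ⟩
  W + W′                                 <⟨ +-monoˡ-< (W + W′) (C-pos k≤n) ⟩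
  V + (W + W′)                           ≤⟨ m≤m+n _ T ⟩
  V + (W + W′) + T                       ≡⟨ rearrange V W W′ T ⟩
  (V + W) + (W′ + T)                     ≡⟨ sym (cong₂ _+_ (pascal n k) (pascal n (2 + k))) ⟩
  (1 + n) C (1 + k) + (1 + n) C (3 + k)  ∎
  where
  open ≤-Reasoning
  V W W′ T : ℕ
  V = n C k
  W = n C (1 + k)
  W′ = n C (2 + k)
  T = n C (3 + k)
  rearrange : ∀ V W W′ T → V + (W + W′) + T ≡ (V + W) + (W′ + T)
  rearrange = solve-∀

C-growth-diagonal : ∀ {n k} → k ≤ n → (1 + n) C (2 + k) + 2 * ((1 + n) C (2 + k)) < (3 + n) C (3 + k)
C-growth-diagonal {n} {k} k≤n = begin-strict
  X + 2 * X          <⟨ +-monoˡ-< (2 * X) (C-middle<neighbours k≤n) ⟩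
  (A + B) + 2 * X    ≡⟨ rearrange A B X ⟩
  (A + X) + (X + B)  ≡⟨ sym (pascal² (1 + n) (1 + k)) ⟩
  (3 + n) C (3 + k)  ∎
  where
  open ≤-Reasoning
  X A B : ℕ
  X = (1 + n) C (2 + k)
  A = (1 + n) C (1 + k)
  B = (1 + n) C (3 + k)
  rearrange : ∀ A B X → (A + B) + 2 * X ≡ (A + X) + (X + B)
  rearrange = solve-∀

-- Suffixes of monotone drawing sequences

_≟ˢ_ : DecidableEquality Sym
plus  ≟ˢ plus  = yes refl
zer   ≟ˢ zer   = yes refl
minus ≟ˢ minus = yes refl
star  ≟ˢ star  = yes refl
plus  ≟ˢ zer   = no λ ()
plus  ≟ˢ minus = no λ ()
plus  ≟ˢ star  = no λ ()
zer   ≟ˢ plus  = no λ ()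
zer   ≟ˢ minus = no λ ()
zer   ≟ˢ star  = no λ ()
minus ≟ˢ plus  = no λ ()
minus ≟ˢ zer   = no λ ()
minus ≟ˢ star  = no λ ()
star  ≟ˢ plus  = no λ ()
star  ≟ˢ zer   = no λ ()
star  ≟ˢ minus = no λ ()

≺-irrefl : ∀ {x} → ¬ x ≺ x
≺-irrefl ()

≺-sign : ∀ {a b} → a ≺ b → IsSign a ⊎ IsSign b
≺-sign m≺z = inj₁ sign-
≺-sign z≺p = inj₂ sign+
≺-sign m≺p = inj₁ sign-

-- Suffixes by their number of 0's: Stars has none, Open (form (ii)) one, Closed (form (i)) two.
data Stars : List Sym → Set where
  []  : Stars []
  ∗∷_ : ∀ {l} → Stars l → Stars (star ∷ l)

data Open : List Sym → Set where
  0∷_ : ∀ {l} → Stars l → Open (zer ∷ l)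
  _∷_ : ∀ {x l} → IsSign x → Open l → Open (x ∷ l)

data Closed : List Sym → Set where
  0∷_ : ∀ {l} → Open l → Closed (zer ∷ l)
  ∗∷_ : ∀ {l} → Closed l → Closed (star ∷ l)

Suffix : List Sym → Set
Suffix l = Stars l ⊎ Open l ⊎ Closed l

open⇒suffix : ∀ {l} → Open l → Suffix l
open⇒suffix = inj₂ ∘ inj₁

stars-replicate : ∀ b → Stars (replicate b star)
stars-replicate zero    = []
stars-replicate (suc b) = ∗∷ stars-replicate b

open-++ : ∀ {w l} → All IsSign w → Stars l → Open (w ++ zer ∷ l)
open-++ []                s = 0∷ s
open-++ (x-sign ∷ w-sign) s = x-sign ∷ open-++ w-sign s

closed-++ : ∀ a {l} → Open l → Closed (replicate a star ++ zer ∷ l)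
closed-++ zero    o = 0∷ o
closed-++ (suc a) o = ∗∷ closed-++ a o

monotoneDrawing⇒suffix : ∀ {l} → MonotoneDrawingList l → Suffix l
monotoneDrawing⇒suffix (form-i a b _ w-sign) = inj₂ (inj₂ (closed-++ a (open-++ w-sign (stars-replicate b))))
monotoneDrawing⇒suffix (form-ii b _ w-sign)  = inj₂ (inj₁ (open-++ w-sign (stars-replicate b)))

suffix-∷⁻ : ∀ {x l} → Suffix (x ∷ l) → Suffix l
suffix-∷⁻ (inj₁ (∗∷ s))        = inj₁ s
suffix-∷⁻ (inj₂ (inj₁ (0∷ s)))  = inj₁ s
suffix-∷⁻ (inj₂ (inj₁ (_ ∷ o))) = inj₂ (inj₁ o)
suffix-∷⁻ (inj₂ (inj₂ (0∷ o)))  = inj₂ (inj₁ o)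
suffix-∷⁻ (inj₂ (inj₂ (∗∷ c)))  = inj₂ (inj₂ c)

sign∷⇒open : ∀ {x l} → IsSign x → Suffix (x ∷ l) → Open l
sign∷⇒open sign+ (inj₂ (inj₁ (_ ∷ o))) = o
sign∷⇒open sign- (inj₂ (inj₁ (_ ∷ o))) = o

stars-¬open : ∀ {l} → Stars l → ¬ Open l
stars-¬open (∗∷ _) (() ∷ _)

closed-¬stars : ∀ {l} → Closed l → ¬ Stars l
closed-¬stars (∗∷ c) (∗∷ s) = closed-¬stars c s

closed-¬open : ∀ {l} → Closed l → ¬ Open l
closed-¬open (0∷ o) (0∷ s)  = stars-¬open s o
closed-¬open (0∷ _) (() ∷ _)
closed-¬open (∗∷ _) (() ∷ _)

star∷⁻ : ∀ {l} → Suffix (star ∷ l) → Stars l ⊎ Closed l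
star∷⁻ (inj₁ (∗∷ s))       = inj₁ s
star∷⁻ (inj₂ (inj₁ (() ∷ _)))
star∷⁻ (inj₂ (inj₂ (∗∷ c))) = inj₂ c

nonstar∷⁻ : ∀ {x l} → x ≢ star → Suffix (x ∷ l) → Stars l ⊎ Open l
nonstar∷⁻ x≢∗ (inj₁ (∗∷ _))        = ⊥-elim (x≢∗ refl)
nonstar∷⁻ _   (inj₂ (inj₁ (0∷ s)))  = inj₁ s
nonstar∷⁻ _   (inj₂ (inj₁ (_ ∷ o))) = inj₂ o
nonstar∷⁻ _   (inj₂ (inj₂ (0∷ o)))  = inj₂ o
nonstar∷⁻ x≢∗ (inj₂ (inj₂ (∗∷ _)))  = ⊥-elim (x≢∗ refl)

shared-tail⇒stars : ∀ {x l} → x ≢ star → Suffix (star ∷ l) → Suffix (x ∷ l) → Stars l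
shared-tail⇒stars x≢∗ s t with star∷⁻ s | nonstar∷⁻ x≢∗ t
... | inj₁ stars  | _           = stars
... | inj₂ closed | inj₁ stars  = ⊥-elim (closed-¬stars closed stars)
... | inj₂ closed | inj₂ opened = ⊥-elim (closed-¬open closed opened)

stars-unique : ∀ {m} (u v : Seq m) → Stars (toList u) → Stars (toList v) → u ≡ v
stars-unique []      []      _      _      = refl
stars-unique (_ ∷ u) (_ ∷ v) (∗∷ s) (∗∷ t) = cong (star ∷_) (stars-unique u v s t)

-- Crossings

-- Cross unfolds to a Σ-type from which Agda cannot infer the two sequences; this wrapper
-- keeps them inferable.
record Crossing {n} (j : ℕ) (u v : Seq n) : Set where
  constructor crossing
  field cross : Cross j u v

-- No sequence crosses itself (crossing-irrefl), so u = v is harmless here.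
CrossFree : ∀ {n} → ℕ → List (Seq n) → Set
CrossFree j F = ∀ {u v} → u ∈ F → v ∈ F → ¬ Crossing j u v

crossing-irrefl : ∀ {n j} {u : Seq n} → ¬ Crossing j u u
crossing-irrefl (crossing (_ , _ , inj₁ alternates)) = ≺-irrefl (alternates zero)
crossing-irrefl (crossing (_ , _ , inj₂ alternates)) = ≺-irrefl (alternates zero)

crossing-sym : ∀ {n j} {u v : Seq n} → Crossing j u v → Crossing j v u
crossing-sym (crossing (i , i↑ , alternates)) = crossing (i , i↑ , Sum.swap alternates)

crossing-∷ : ∀ {n j x y} {u v : Seq n} → Crossing j u v → Crossing j (x ∷ u) (y ∷ v)
crossing-∷ (crossing (i , i↑ , alternates)) = crossing (suc ∘ i , (λ s t s<t → s≤s (i↑ s t s<t)) , alternates)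

crossing-head : ∀ {n x y} {u v : Seq n} → x ≺ y → Crossing 0 (x ∷ u) (y ∷ v)
crossing-head x≺y = crossing ((λ _ → zero) , (λ { zero zero () }) , inj₁ λ { zero → x≺y })

¬crossing-length : ∀ {m} {u v : Seq m} → ¬ Crossing m u v
¬crossing-length {m} (crossing (i , i↑ , _)) with s , t , s<t , iₛ≡iₜ ← pigeonhole (n<1+n m) i =
  <-irrefl (cong toℕ iₛ≡iₜ) (i↑ s t s<t)

if-even-suc : ∀ n {P Q : Set} → (if even n then P else Q) → if even (suc n) then Q else P
if-even-suc zero          p = p
if-even-suc (suc zero)    q = q
if-even-suc (suc (suc n)) r = if-even-suc n r

prependZero : ∀ {j n} → (Fin (suc j) → Fin n) → Fin (suc (suc j)) → Fin (suc n)
prependZero i zero    = zero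
prependZero i (suc t) = suc (i t)

prependZero-increasing : ∀ {j n} {i : Fin (suc j) → Fin n} → StrictlyIncreasing i → StrictlyIncreasing (prependZero i)
prependZero-increasing i↑ zero    (suc t) _         = s≤s z≤n
prependZero-increasing i↑ (suc s) (suc t) (s≤s s<t) = s≤s (i↑ s t s<t)

alternatesFromBelow-∷ : ∀ {n j x y} {u v : Seq n} {i : Fin (suc j) → Fin n} →
                        AlternatesFromBelow u v i → y ≺ x → AlternatesFromBelow (y ∷ v) (x ∷ u) (prependZero i)
alternatesFromBelow-∷ alternates y≺x zero    = y≺x
alternatesFromBelow-∷ alternates y≺x (suc t) = if-even-suc (toℕ t) (alternates t)

-- Whichever of u, v starts below, one of the two prepended pairs adds a crossing in front.
crossing-suc : ∀ {n j a₁ b₁ a₂ b₂} {u v : Seq n} → a₁ ≺ b₂ → a₂ ≺ b₁ → Crossing j u v →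
               Crossing (suc j) (b₁ ∷ u) (a₂ ∷ v) ⊎ Crossing (suc j) (a₁ ∷ u) (b₂ ∷ v)
crossing-suc _ a₂≺b₁ (crossing (i , i↑ , inj₁ alternates)) =
  inj₁ (crossing (prependZero i , prependZero-increasing i↑ , inj₂ (alternatesFromBelow-∷ alternates a₂≺b₁)))
crossing-suc a₁≺b₂ _ (crossing (i , i↑ , inj₂ alternates)) =
  inj₂ (crossing (prependZero i , prependZero-increasing i↑ , inj₁ (alternatesFromBelow-∷ alternates a₁≺b₂)))

crossFree-length : ∀ {m} (F : List (Seq m)) → CrossFree m F
crossFree-length _ _ _ = ¬crossing-length

allPairs⇒crossFree : ∀ {n k} {F : List (Seq n)} → AllPairs (CrossAtMost k) F → CrossFree (suc k) F
allPairs⇒crossFree (_ ∷ _)      (here refl) (here refl) = crossing-irrefl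
allPairs⇒crossFree (u≁ ∷ _)     (here refl) (there v∈)  = All.lookup u≁ v∈ ∘ Crossing.cross
allPairs⇒crossFree (v≁ ∷ _)     (there u∈)  (here refl) = All.lookup v≁ u∈ ∘ Crossing.cross ∘ crossing-sym
allPairs⇒crossFree (_ ∷ F-free) (there u∈)  (there v∈)  = allPairs⇒crossFree F-free u∈ v∈

open-unique : ∀ {m} (u v : Seq m) → Open (toList u) → Open (toList v) → ¬ Crossing 0 u v → u ≡ v
open-unique (_ ∷ u) (_ ∷ v) (0∷ s)      (0∷ t)      _  = cong (zer ∷_) (stars-unique u v s t)
open-unique (_ ∷ u) (_ ∷ v) (sign+ ∷ o) (sign+ ∷ p) ¬c = cong (plus ∷_) (open-unique u v o p (¬c ∘ crossing-∷))
open-unique (_ ∷ u) (_ ∷ v) (sign- ∷ o) (sign- ∷ p) ¬c = cong (minus ∷_) (open-unique u v o p (¬c ∘ crossing-∷))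
open-unique (_ ∷ _) (_ ∷ _) (0∷ _)      (sign+ ∷ _) ¬c = ⊥-elim (¬c (crossing-head z≺p))
open-unique (_ ∷ _) (_ ∷ _) (0∷ _)      (sign- ∷ _) ¬c = ⊥-elim (¬c (crossing-sym (crossing-head m≺z)))
open-unique (_ ∷ _) (_ ∷ _) (sign+ ∷ _) (0∷ _)      ¬c = ⊥-elim (¬c (crossing-sym (crossing-head z≺p)))
open-unique (_ ∷ _) (_ ∷ _) (sign- ∷ _) (0∷ _)      ¬c = ⊥-elim (¬c (crossing-head m≺z))
open-unique (_ ∷ _) (_ ∷ _) (sign+ ∷ _) (sign- ∷ _) ¬c = ⊥-elim (¬c (crossing-sym (crossing-head m≺p)))
open-unique (_ ∷ _) (_ ∷ _) (sign- ∷ _) (sign+ ∷ _) ¬c = ⊥-elim (¬c (crossing-head m≺p))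

-- Splitting a family by its first symbol

tailsWith : ∀ {m} → Sym → List (Seq (suc m)) → List (Seq m)
tailsWith x [] = []
tailsWith x ((y ∷ z) ∷ F) with x ≟ˢ y
... | yes _ = z ∷ tailsWith x F
... | no  _ = tailsWith x F

∈-tailsWith⁻ : ∀ {m x z} (F : List (Seq (suc m))) → z ∈ tailsWith x F → (x ∷ z) ∈ F
∈-tailsWith⁻ {x = x} ((y ∷ _) ∷ F) z∈ with x ≟ˢ y
∈-tailsWith⁻ _ (here refl) | yes refl = here refl
∈-tailsWith⁻ F (there z∈)  | yes refl = there (∈-tailsWith⁻ _ z∈)
∈-tailsWith⁻ F z∈          | no _     = there (∈-tailsWith⁻ _ z∈)

tailsWith-unique : ∀ {m x} {F : List (Seq (suc m))} → Unique F → Unique (tailsWith x F)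
tailsWith-unique {F = []} [] = []
tailsWith-unique {x = x} {F = (y ∷ z) ∷ F} (x∷z∉ ∷ F!) with x ≟ˢ y
... | yes refl =
  All.tabulate (λ z′∈ z≡z′ → All.lookup x∷z∉ (∈-tailsWith⁻ F z′∈) (cong (x ∷_) z≡z′)) ∷ tailsWith-unique F!
... | no  _    = tailsWith-unique F!

length-tailsWith : ∀ {m} (F : List (Seq (suc m))) →
  length F ≡ length (tailsWith minus F) + length (tailsWith zer F)
             + length (tailsWith plus F) + length (tailsWith star F)
length-tailsWith [] = refl
length-tailsWith ((minus ∷ _) ∷ F) = cong suc (length-tailsWith F)
length-tailsWith ((zer ∷ _) ∷ F) =
  trans (cong suc (length-tailsWith F)) (cong (λ s → s + # plus + # star) (sym (+-suc (# minus) (# zer))))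
  where # : Sym → ℕ
        # x = length (tailsWith x F)
length-tailsWith ((plus ∷ _) ∷ F) =
  trans (cong suc (length-tailsWith F)) (cong (_+ # star) (sym (+-suc (# minus + # zer) (# plus))))
  where # : Sym → ℕ
        # x = length (tailsWith x F)
length-tailsWith ((star ∷ _) ∷ F) =
  trans (cong suc (length-tailsWith F)) (sym (+-suc (# minus + # zer + # plus) (# star)))
  where # : Sym → ℕ
        # x = length (tailsWith x F)

Fork : ∀ {m} → List (Seq (suc m)) → Sym → Seq m → Set
Fork F c z = (c ∷ z) ∈ F × ∃[ a ] a ≺ c × (a ∷ z) ∈ F

fork-open : ∀ {m c z} {F : List (Seq (suc m))} → All (Suffix ∘ toList) F → Fork F c z → Open (toList z)
fork-open F-suffix (c∷z∈ , a , a≺c , a∷z∈) with ≺-sign a≺c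
... | inj₁ a-sign = sign∷⇒open a-sign (All.lookup F-suffix a∷z∈)
... | inj₂ c-sign = sign∷⇒open c-sign (All.lookup F-suffix c∷z∈)

forks-crossFree : ∀ {m j c} {F : List (Seq (suc m))} {G : List (Seq m)} →
                  (∀ {z} → z ∈ G → Fork F c z) → CrossFree (suc j) F → CrossFree j G
forks-crossFree fork F-free z₁∈ z₂∈ z₁⋈z₂ =
  let c∷z₁∈ , _ , a₁≺c , a₁∷z₁∈ = fork z₁∈
      c∷z₂∈ , _ , a₂≺c , a₂∷z₂∈ = fork z₂∈
  in [ F-free c∷z₁∈ a₂∷z₂∈ , F-free a₁∷z₁∈ c∷z₂∈ ]′ (crossing-suc a₁≺c a₂≺c z₁⋈z₂)

module Decomposition {m : ℕ} (F : List (Seq (suc m))) (F! : Unique F) (F-suffix : All (Suffix ∘ toList) F) where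
  open ListSet (≡-dec {n = m} _≟ˢ_)

  private
    P : Sym → List (Seq m)
    P x = tailsWith x F

    P! : ∀ x → Unique (P x)
    P! x = tailsWith-unique F!

  nonstarTails tails starTails forks₊ forks₀ : List (Seq m)
  nonstarTails = (P minus ∪ P zer) ∪ P plus
  tails        = nonstarTails ∪ P star
  starTails    = nonstarTails ∩ P star
  forks₊       = (P minus ∪ P zer) ∩ P plus
  forks₀       = P minus ∩ P zer

  length-decomposition : length F ≡ length tails + length starTails + length forks₊ + length forks₀
  length-decomposition =
    trans (length-tailsWith F) (sym (length-∪-∩⁴ (P minus) (P zer) (P plus) (P star)))

  ∈-nonstarTails⁻ : ∀ {z} → z ∈ nonstarTails → ∃[ x ] x ≢ star × (x ∷ z) ∈ F
  ∈-nonstarTails⁻ z∈ with ∈-∪⁻ (P minus ∪ P zer) z∈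
  ... | inj₂ z∈₊ = plus , (λ ()) , ∈-tailsWith⁻ F z∈₊
  ... | inj₁ z∈₋₀ with ∈-∪⁻ (P minus) z∈₋₀
  ...   | inj₁ z∈₋ = minus , (λ ()) , ∈-tailsWith⁻ F z∈₋
  ...   | inj₂ z∈₀ = zer , (λ ()) , ∈-tailsWith⁻ F z∈₀

  ∈-tails⁻ : ∀ {z} → z ∈ tails → ∃[ x ] (x ∷ z) ∈ F
  ∈-tails⁻ z∈ with ∈-∪⁻ nonstarTails z∈
  ... | inj₁ z∈′ = let x , _ , x∷z∈ = ∈-nonstarTails⁻ z∈′ in x , x∷z∈
  ... | inj₂ z∈∗ = star , ∈-tailsWith⁻ F z∈∗

  tails-unique : Unique tails
  tails-unique = ∪-unique (∪-unique (∪-unique (P! minus) (P! zer)) (P! plus)) (P! star)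

  tails-suffix : All (Suffix ∘ toList) tails
  tails-suffix = All.tabulate λ z∈ → suffix-∷⁻ (All.lookup F-suffix (proj₂ (∈-tails⁻ z∈)))

  tails-crossFree : ∀ {j} → CrossFree j F → CrossFree j tails
  tails-crossFree F-free u∈ v∈ = F-free (proj₂ (∈-tails⁻ u∈)) (proj₂ (∈-tails⁻ v∈)) ∘ crossing-∷

  starTails-length≤1 : length starTails ≤ 1
  starTails-length≤1 = length≤1 (∩-unique (P! star)) λ z₁∈ z₂∈ → stars-unique _ _ (stars z₁∈) (stars z₂∈)
    where
    stars : ∀ {z} → z ∈ starTails → Stars (toList z)
    stars z∈ =
      let z∈′ , z∈∗ = ∈-∩⁻ nonstarTails z∈
          x , x≢∗ , x∷z∈ = ∈-nonstarTails⁻ z∈′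
      in shared-tail⇒stars x≢∗ (All.lookup F-suffix (∈-tailsWith⁻ F z∈∗)) (All.lookup F-suffix x∷z∈)

  forks₊-unique : Unique forks₊
  forks₊-unique = ∩-unique (P! plus)

  forks₀-unique : Unique forks₀
  forks₀-unique = ∩-unique (P! zer)

  forks₊-fork : ∀ {z} → z ∈ forks₊ → Fork F plus z
  forks₊-fork z∈ with z∈₋₀ , z∈₊ ← ∈-∩⁻ (P minus ∪ P zer) z∈ | ∈-∪⁻ (P minus) z∈₋₀
  ... | inj₁ z∈₋ = ∈-tailsWith⁻ F z∈₊ , minus , m≺p , ∈-tailsWith⁻ F z∈₋
  ... | inj₂ z∈₀ = ∈-tailsWith⁻ F z∈₊ , zer , z≺p , ∈-tailsWith⁻ F z∈₀

  forks₀-fork : ∀ {z} → z ∈ forks₀ → Fork F zer z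
  forks₀-fork z∈ = let z∈₋ , z∈₀ = ∈-∩⁻ (P minus) z∈ in ∈-tailsWith⁻ F z∈₀ , minus , m≺z , ∈-tailsWith⁻ F z∈₋

-- Bounds on families

FamilyBound : ∀ {m} → (Seq m → Set) → ℕ → ℕ → Set
FamilyBound {m} P j b = (F : List (Seq m)) → Unique F → All P F → CrossFree j F → length F ≤ b

familyBound-mono : ∀ {m j b b′} {P : Seq m → Set} → b ≤ b′ → FamilyBound P j b → FamilyBound P j b′
familyBound-mono b≤b′ bound F F! F-P F-free = ≤-trans (bound F F! F-P F-free) b≤b′

familyBound-⊆ : ∀ {m j b} {P Q : Seq m → Set} → (∀ {u} → P u → Q u) → FamilyBound Q j b → FamilyBound P j b
familyBound-⊆ P⊆Q bound F F! F-P = bound F F! (All.map P⊆Q F-P)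

familyBound-length : ∀ {m b j} {P : Seq m → Set} → FamilyBound P m b → FamilyBound P j b
familyBound-length bound F F! F-P _ = bound F F! F-P (crossFree-length F)

familyBound-nil : ∀ {j} {P : Seq 0 → Set} → FamilyBound P j 1
familyBound-nil F F! _ _ = length≤1 F! λ { {[]} {[]} _ _ → refl }

open-familyBound-nil : ∀ {j} → FamilyBound {0} (Open ∘ toList) j 0
open-familyBound-nil []      _ _             _ = z≤n
open-familyBound-nil ([] ∷ _) _ (() ∷ _) _

open-familyBound-cross0 : ∀ {m} → FamilyBound {m} (Open ∘ toList) 0 1
open-familyBound-cross0 G G! G-open G-free =
  length≤1 G! λ u∈ v∈ → open-unique _ _ (All.lookup G-open u∈) (All.lookup G-open v∈) (G-free u∈ v∈)

familyBound-suc : ∀ {m i b b′} →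
  FamilyBound {m} (Suffix ∘ toList) (suc i) b → FamilyBound {m} (Open ∘ toList) i b′ →
  FamilyBound {suc m} (Suffix ∘ toList) (suc i) (b + 1 + b′ + b′)
familyBound-suc {b = b} {b′} tails-bound forks-bound F F! F-suffix F-free = begin
  length F                                                         ≡⟨ length-decomposition ⟩
  length tails + length starTails + length forks₊ + length forks₀  ≤⟨ +-mono-≤ (+-mono-≤ (+-mono-≤
    tails≤ starTails-length≤1) (forks≤ forks₊-unique forks₊-fork)) (forks≤ forks₀-unique forks₀-fork) ⟩
  b + 1 + b′ + b′                                                  ∎
  where
  open Decomposition F F! F-suffix
  open ≤-Reasoning
  tails≤ : length tails ≤ b
  tails≤ = tails-bound tails tails-unique tails-suffix (tails-crossFree F-free)
  forks≤ : ∀ {G c} → Unique G → (∀ {z} → z ∈ G → Fork F c z) → length G ≤ b′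
  forks≤ G! fork = forks-bound _ G! (All.tabulate (fork-open F-suffix ∘ fork)) (forks-crossFree fork F-free)

x+y<z⇒2x+1+y+y≤2z : ∀ x y {z} → x + y < z → 2 * x + 1 + y + y ≤ 2 * z
x+y<z⇒2x+1+y+y≤2z x y {z} x+y<z = begin
  2 * x + 1 + y + y  ≡⟨ rearrange x y ⟩
  1 + 2 * (x + y)    ≤⟨ n≤1+n _ ⟩
  2 + 2 * (x + y)    ≡⟨ sym (*-suc 2 (x + y)) ⟩
  2 * suc (x + y)    ≤⟨ *-monoʳ-≤ 2 x+y<z ⟩
  2 * z              ∎
  where
  open ≤-Reasoning
  rearrange : ∀ x y → 2 * x + 1 + y + y ≡ 1 + 2 * (x + y)
  rearrange = solve-∀

-- Only [∗] and [0] are suffixes of length 1; the closed form 2 * (2 C 1) = 4 would break the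
-- step to length 2 (bound-diagonal zero), as 3 * 4 + 1 > 2 * (4 C 2). The value at length 0 is
-- never used.
bound : ℕ → ℕ → ℕ
bound m@(suc (suc _)) j = 2 * ((2 * m) C j)
bound _               _ = 2

bound-suc₁ : ∀ m → bound (suc m) 1 + 1 + 1 + 1 ≤ bound (2 + m) 1
bound-suc₁ zero    = m≤m+n 5 3
bound-suc₁ (suc m) = x+y<z⇒2x+1+y+y≤2z ((2 * (2 + m)) C 1) 1 (begin-strict
  (2 * (2 + m)) C 1 + 1  ≡⟨ cong (_+ 1) (nC1≡n (2 * (2 + m))) ⟩
  2 * (2 + m) + 1        ≡⟨ +-comm (2 * (2 + m)) 1 ⟩
  1 + 2 * (2 + m)        <⟨ n<1+n _ ⟩
  2 + 2 * (2 + m)        ≡⟨ sym (*-suc 2 (2 + m)) ⟩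
  2 * (3 + m)            ≡⟨ sym (nC1≡n (2 * (3 + m))) ⟩
  (2 * (3 + m)) C 1      ∎)
  where open ≤-Reasoning

bound-suc : ∀ {m i} → suc i < m →
            bound m (2 + i) + 1 + bound m (1 + i) + bound m (1 + i) ≤ bound (suc m) (2 + i)
bound-suc {m@(suc (suc _))} {i} 1+i<m =
  x+y<z⇒2x+1+y+y≤2z X Y (subst (X + Y <_) (sym (cong (_C (2 + i)) (*-suc 2 m))) (C-growth i≤2m))
  where
  X Y : ℕ
  X = (2 * m) C (2 + i)
  Y = 2 * ((2 * m) C (1 + i))
  i≤2m : i ≤ 2 * m
  i≤2m = ≤-trans (≤-trans (n≤1+n i) (<⇒≤ 1+i<m)) (m≤n*m m 2)
bound-suc {suc zero} (s≤s ())

bound-diagonal : ∀ m → bound (suc m) (suc m) + 1 + bound (suc m) (suc m) + bound (suc m) (suc m)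
                         ≤ bound (2 + m) (2 + m)
bound-diagonal zero    = m≤m+n 7 5
bound-diagonal (suc m) = x+y<z⇒2x+1+y+y≤2z X (2 * X)
  (subst₂ (λ a b → a C (2 + m) + 2 * (a C (2 + m)) < b C (3 + m)) (sym (e₂ m)) (sym (e₃ m))
          (C-growth-diagonal (≤-trans (m≤n*m m 2) (m≤n+m _ 3))))
  where
  X : ℕ
  X = (2 * (2 + m)) C (2 + m)
  e₂ : ∀ m → 2 * (2 + m) ≡ 1 + (3 + 2 * m)
  e₂ = solve-∀
  e₃ : ∀ m → 2 * (3 + m) ≡ 3 + (3 + 2 * m)
  e₃ = solve-∀

suffix-familyBound : ∀ m i → i < m → FamilyBound {m} (Suffix ∘ toList) (suc i) (bound m (suc i))
suffix-familyBound (suc zero)    zero _ = familyBound-suc familyBound-nil open-familyBound-nil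
suffix-familyBound (suc (suc m)) zero _ =
  familyBound-mono (bound-suc₁ m)
    (familyBound-suc (suffix-familyBound (suc m) zero (s≤s z≤n)) open-familyBound-cross0)
suffix-familyBound (suc m) (suc i) (s≤s i<m) with m≤n⇒m<n∨m≡n i<m
... | inj₁ 1+i<m = familyBound-mono (bound-suc 1+i<m)
  (familyBound-suc (suffix-familyBound m (suc i) 1+i<m)
                   (familyBound-⊆ open⇒suffix (suffix-familyBound m i i<m)))
-- The tails have length m = suc i, so no two of them cross m times.
... | inj₂ refl  = familyBound-mono (bound-diagonal i)
  (familyBound-suc (familyBound-length (suffix-familyBound (suc i) i i<m))
                   (familyBound-⊆ open⇒suffix (suffix-familyBound (suc i) i i<m)))

lemma9 : (k n : ℕ) → 0 < k → k < n →
    (𝒜 : List (Seq n)) → Unique 𝒜 →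
    All MonotoneDrawingSeq 𝒜 →
    AllPairs (CrossAtMost k) 𝒜 →
    length 𝒜 ≤ 2 * ((2 * n) C (suc k))
lemma9 k@(suc _) n@(suc (suc _)) _ k<n 𝒜 𝒜! 𝒜-drawing 𝒜-crossings =
  suffix-familyBound n k k<n 𝒜 𝒜! (All.map monotoneDrawing⇒suffix 𝒜-drawing) (allPairs⇒crossFree 𝒜-crossings)
lemma9 (suc _) (suc zero) _ (s≤s ()) _ _ _ _
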